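{- Let $N\ge2$. Let $G$ be the group of bijections of $\{1,\dots,N\}^3$ generated by (i) the interchanges of two parallel layers, i.e. the maps $(i,j,k)\mapsto(\tau(i),j,k)$, $(i,j,k)\mapsto(i,\tau(j),k)$, $(i,j,k)\mapsto(i,j,\tau(k))$ for transpositions $\tau$ of $\{1,\dots,N\}$; (ii) the 24 rotational symmetries of the cube $[1,N]^3$ restricted to its lattice points; (iii) the reflectional symmetries of the cube $[1,N]^3$ restricted to its lattice points. Let $H$ be the group of all bijections $f$ of $\{1,\dots,N\}^3$ such that whenever eight points form the vertex set of a box, their images under $f$ also form the vertex set of a box. Then $G\subseteq H$; if $N=2$, $H$ is strictly larger than $G$; and if $N\ge3$, $H=G$.
   Context: A (rectangular) box in the grid $\{1,\dots,N\}^3$ is a set $\{i_1,i_2\}\times\{j_1,j_2\}\times\{k_1,k_2\}$ with $i_1\neq i_2$, $j_1\neq j_2$, $k_1\neq k_2$. -}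

module Defs where

open import Data.Nat using (ℕ)
open import Data.Bool using (Bool; if_then_else_)
open import Data.Fin using (Fin; zero; suc; opposite)
open import Data.Fin.Permutation using (Permutation′; transpose; _⟨$⟩ʳ_)
open import Data.Product using (Σ; _×_; _,_; proj₁; proj₂; ∃)
open import Data.Sum using (_⊎_)
open import Function using (id; _∘_; _⇔_)
open import Function.Definitions using (Bijective)
open import Relation.Binary.PropositionalEquality using (_≡_; _≢_)

-- Lattice points of the cube: {1..N}^3, realised as (Fin N)^3 (coordinates 0..N-1).
Point : ℕ → Set
Point N = Fin N × Fin N × Fin N

layerX layerY layerZ : ∀ {N} → Fin N → Fin N → Point N → Point N
layerX a b (i , j , k) = (transpose a b ⟨$⟩ʳ i , j , k)
layerY a b (i , j , k) = (i , transpose a b ⟨$⟩ʳ j , k)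
layerZ a b (i , j , k) = (i , j , transpose a b ⟨$⟩ʳ k)

coord : ∀ {N} → Point N → Fin 3 → Fin N
coord (i , j , k) zero = i
coord (i , j , k) (suc zero) = j
coord (i , j , k) (suc (suc zero)) = k

-- Symmetries of the cube [1,N]^3 restricted to lattice points (rotations and
-- reflections together): permute coordinates by σ, then reflect coordinate c
-- (x ↦ N+1-x, i.e. opposite on Fin N) whenever ε c is true.
cubeSym : ∀ {N} → Permutation′ 3 → (Fin 3 → Bool) → Point N → Point N
cubeSym σ ε p = (f zero , f (suc zero) , f (suc (suc zero)))
  where
  f : Fin 3 → _
  f c = if ε c then opposite (coord p (σ ⟨$⟩ʳ c)) else coord p (σ ⟨$⟩ʳ c)

data InG (N : ℕ) : (Point N → Point N) → Set where
  genX : (a b : Fin N) → a ≢ b → InG N (layerX a b)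
  genY : (a b : Fin N) → a ≢ b → InG N (layerY a b)
  genZ : (a b : Fin N) → a ≢ b → InG N (layerZ a b)
  genCube : (σ : Permutation′ 3) (ε : Fin 3 → Bool) → InG N (cubeSym σ ε)
  idG : InG N id
  compG : ∀ {f g} → InG N f → InG N g → InG N (f ∘ g)
  invG : ∀ {f} → InG N f → (g : Point N → Point N) →
         (∀ x → g (f x) ≡ x) → (∀ x → f (g x) ≡ x) → InG N g
  extG : ∀ {f g} → InG N f → (∀ x → f x ≡ g x) → InG N g

record BoxData (N : ℕ) : Set where
  constructor box
  field
    i₁ i₂ j₁ j₂ k₁ k₂ : Fin N
    i≢ : i₁ ≢ i₂
    j≢ : j₁ ≢ j₂
    k≢ : k₁ ≢ k₂

InBox : ∀ {N} → BoxData N → Point N → Set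
InBox (box i₁ i₂ j₁ j₂ k₁ k₂ _ _ _) (i , j , k) =
  (i ≡ i₁ ⊎ i ≡ i₂) × (j ≡ j₁ ⊎ j ≡ j₂) × (k ≡ k₁ ⊎ k ≡ k₂)

ImageIsBox : ∀ {N} → (Point N → Point N) → BoxData N → BoxData N → Set
ImageIsBox f B B' = ∀ q → (∃ λ p → InBox B p × f p ≡ q) ⇔ InBox B' q

InH : (N : ℕ) → (Point N → Point N) → Set
InH N f = Bijective _≡_ _≡_ f × (∀ (B : BoxData N) → Σ (BoxData N) λ B' → ImageIsBox f B B')

-- G consists of the product maps p ↦ (ψ c (p (σ c)))_c, a permutation σ of the axes followed
-- by a permutation ψ c of the layers along each axis: the generators have this form, the form
-- is stable under composition and inversion, and conversely a product map is a cube symmetry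
-- followed by layer permutations, which decompose into layer interchanges. Product maps send
-- boxes to boxes, so G ⊆ H.
--
-- For N = 2 every box is the whole grid, so H contains every bijection, e.g. the transposition
-- of two adjacent corners; it is not in G since it makes the opposite corners (0,0,0) and
-- (1,1,1) share a coordinate, which no product map does.
--
-- For N ≥ 3 take f ∈ H. Its inverse is an iterate of f, so both preserve the relation "p, q, r
-- lie on a common box". The span of p, q (the points forming such a triple with them) detects
-- lines: the pairs differing in exactly one coordinate are the distinct pairs with maximal span.
-- Hence f maps lines to lines; comparing spans shows that all lines along axis c go to lines
-- along one axis σ′ c, and then coordinate u of f p depends only, and injectively, on coordinate
-- σ′⁻¹ u of p. So f is a product map.

module Submission where

open import Defs
open import Data.Bool using (true; false; if_then_else_)
open import Data.Empty using (⊥-elim)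
open import Data.Fin using (Fin; zero; suc; toℕ; combine; punchIn; opposite)
open import Data.Fin.Patterns using (0F; 1F; 2F)
open import Data.Fin.Permutation as Perm
  using (Permutation′; _⟨$⟩ʳ_; _⟨$⟩ˡ_; _∘ₚ_; permutation; transpose; reverse; inverseˡ; inverseʳ)
open import Data.Fin.Permutation.Transposition.List using (eval; decompose; eval-decompose)
open import Data.Fin.Properties using (_≟_; pigeonhole; toℕ≤pred[n]; combine-injective; punchInᵢ≢i)
open import Data.List using ([]; _∷_)
open import Data.Nat using (ℕ; zero; suc; _+_; _*_; _∸_; _≤_; _<_; pred; s≤s; _!)
open import Data.Nat.Divisibility using (divides; ∣-trans; m∣m*n; m≤n⇒m!∣n!)
open import Data.Nat.GeneralisedArithmetic using (fold; fold-+)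
open import Data.Nat.Properties using (n<1+n; ≤-trans; <⇒≤; m∸n≤m; m<n⇒0<n∸m; m+[n∸m]≡n; suc-pred; _!≢0)
open import Data.Product using (Σ; ∃; ∃₂; _×_; _,_; proj₁; proj₂)
open import Data.Sum using (_⊎_; inj₁; inj₂)
import Data.Sum as Sum
open import Function using (id; _∘_; mk⇔; Equivalence)
open import Function.Consequences.Propositional
  using (strictlyInverseˡ⇒inverseˡ; strictlyInverseʳ⇒inverseʳ; inverseᵇ⇒bijective)
open import Function.Definitions using (Injective; Bijective)
open import Relation.Binary.PropositionalEquality
  using (_≡_; _≢_; refl; sym; trans; cong; cong₂; subst; subst₂; _≗_; module ≡-Reasoning)
open import Relation.Nullary using (¬_; yes; no)
open import Relation.Unary using (_⊆_)

private
  variable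
    m N : ℕ

coord-extensional : {p q : Point N} → (∀ c → coord p c ≡ coord q c) → p ≡ q
coord-extensional e = cong₂ _,_ (e 0F) (cong₂ _,_ (e 1F) (e 2F))

fromCoords : (Fin 3 → Fin N) → Point N
fromCoords v = v 0F , v 1F , v 2F

coord-fromCoords : (v : Fin 3 → Fin N) (c : Fin 3) → coord (fromCoords v) c ≡ v c
coord-fromCoords v 0F = refl
coord-fromCoords v 1F = refl
coord-fromCoords v 2F = refl

≢⇒coord≢ : {p q : Point N} → p ≢ q → ∃ λ c → coord p c ≢ coord q c
≢⇒coord≢ {p = p} {q} p≢q with coord p 0F ≟ coord q 0F | coord p 1F ≟ coord q 1F | coord p 2F ≟ coord q 2F
... | no ≢₀ | _      | _      = 0F , ≢₀
... | yes _ | no ≢₁  | _      = 1F , ≢₁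
... | yes _ | yes _  | no ≢₂  = 2F , ≢₂
... | yes ≡₀ | yes ≡₁ | yes ≡₂ = ⊥-elim (p≢q (cong₂ _,_ ≡₀ (cong₂ _,_ ≡₁ ≡₂)))

infixl 6 _[_]≔_

_[_]≔_ : Point N → Fin 3 → Fin N → Point N
(a , b , c) [ 0F ]≔ w = w , b , c
(a , b , c) [ 1F ]≔ w = a , w , c
(a , b , c) [ 2F ]≔ w = a , b , w

coord∘[]≔ : ∀ (p : Point N) c {w} → coord (p [ c ]≔ w) c ≡ w
coord∘[]≔ p 0F = refl
coord∘[]≔ p 1F = refl
coord∘[]≔ p 2F = refl

coord∘[]≔′ : ∀ (p : Point N) {c d w} → d ≢ c → coord (p [ c ]≔ w) d ≡ coord p d
coord∘[]≔′ p {0F} {0F} d≢c = ⊥-elim (d≢c refl)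
coord∘[]≔′ p {0F} {1F} d≢c = refl
coord∘[]≔′ p {0F} {2F} d≢c = refl
coord∘[]≔′ p {1F} {0F} d≢c = refl
coord∘[]≔′ p {1F} {1F} d≢c = ⊥-elim (d≢c refl)
coord∘[]≔′ p {1F} {2F} d≢c = refl
coord∘[]≔′ p {2F} {0F} d≢c = refl
coord∘[]≔′ p {2F} {1F} d≢c = refl
coord∘[]≔′ p {2F} {2F} d≢c = ⊥-elim (d≢c refl)

[]≔-coord : ∀ (p : Point N) c → p [ c ]≔ coord p c ≡ p
[]≔-coord p 0F = refl
[]≔-coord p 1F = refl
[]≔-coord p 2F = refl

origin : Point (suc m)
origin = zero , zero , zero

axis : Fin 3 → Fin (suc m) → Point (suc m)
axis c a = origin [ c ]≔ a

depends-only : ∀ {A : Set} (F : Point (suc m) → A) x → (∀ {p c w} → c ≢ x → F (p [ c ]≔ w) ≡ F p) →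
               ∀ p → F p ≡ F (axis x (coord p x))
depends-only F 0F inv (a , b , c) = trans (sym (inv {a , b , c} {2F} (λ ()))) (sym (inv {a , b , zero} {1F} (λ ())))
depends-only F 1F inv (a , b , c) = trans (sym (inv {a , b , c} {2F} (λ ()))) (sym (inv {a , b , zero} {0F} (λ ())))
depends-only F 2F inv (a , b , c) = trans (sym (inv {a , b , c} {1F} (λ ()))) (sym (inv {a , zero , c} {0F} (λ ())))

OneOf : Fin N → Fin N → Fin N → Set
OneOf v w x = x ≡ v ⊎ x ≡ w

oneOf-map : ∀ (h : Fin N → Fin N) {v w x} → OneOf v w x → OneOf (h v) (h w) (h x)
oneOf-map h = Sum.map (cong h) (cong h)

lo hi : BoxData N → Fin 3 → Fin N
lo B 0F = BoxData.i₁ B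
lo B 1F = BoxData.j₁ B
lo B 2F = BoxData.k₁ B
hi B 0F = BoxData.i₂ B
hi B 1F = BoxData.j₂ B
hi B 2F = BoxData.k₂ B

lo≢hi : (B : BoxData N) (c : Fin 3) → lo B c ≢ hi B c
lo≢hi B 0F = BoxData.i≢ B
lo≢hi B 1F = BoxData.j≢ B
lo≢hi B 2F = BoxData.k≢ B

fromBounds : (l h : Fin 3 → Fin N) → (∀ c → l c ≢ h c) → BoxData N
fromBounds l h l≢h = box (l 0F) (h 0F) (l 1F) (h 1F) (l 2F) (h 2F) (l≢h 0F) (l≢h 1F) (l≢h 2F)

inBox⁺ : ∀ (l h : Fin 3 → Fin N) l≢h {p} → (∀ c → OneOf (l c) (h c) (coord p c)) → InBox (fromBounds l h l≢h) p
inBox⁺ l h l≢h p∈ = p∈ 0F , p∈ 1F , p∈ 2F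

inBox⁻ : ∀ (l h : Fin 3 → Fin N) l≢h {p} → InBox (fromBounds l h l≢h) p → ∀ c → OneOf (l c) (h c) (coord p c)
inBox⁻ l h l≢h (x∈ , y∈ , z∈) 0F = x∈
inBox⁻ l h l≢h (x∈ , y∈ , z∈) 1F = y∈
inBox⁻ l h l≢h (x∈ , y∈ , z∈) 2F = z∈

inverse⇒bijective : ∀ {f g : Point N → Point N} → (∀ q → f (g q) ≡ q) → (∀ p → g (f p) ≡ p) →
                    Bijective _≡_ _≡_ f
inverse⇒bijective {f = f} f∘g g∘f =
  inverseᵇ⇒bijective (strictlyInverseˡ⇒inverseˡ f f∘g , strictlyInverseʳ⇒inverseʳ f g∘f)

-- Product maps

record ProductMap (N : ℕ) : Set where
  field
    axes   : Permutation′ 3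
    scales : Fin 3 → Permutation′ N

open ProductMap

⟦_⟧ : ProductMap N → Point N → Point N
⟦ M ⟧ p = fromCoords λ c → scales M c ⟨$⟩ʳ coord p (axes M ⟨$⟩ʳ c)

coord-⟦⟧ : ∀ (M : ProductMap N) p c → coord (⟦ M ⟧ p) c ≡ scales M c ⟨$⟩ʳ coord p (axes M ⟨$⟩ʳ c)
coord-⟦⟧ M p = coord-fromCoords _

⟨$⟩ʳ-injective : ∀ (π : Permutation′ N) → Injective _≡_ _≡_ (π ⟨$⟩ʳ_)
⟨$⟩ʳ-injective π e = trans (sym (inverseˡ π)) (trans (cong (π ⟨$⟩ˡ_) e) (inverseˡ π))

⟦⟧-agree : ∀ (M : ProductMap N) {p q} c →
           coord (⟦ M ⟧ p) c ≡ coord (⟦ M ⟧ q) c → coord p (axes M ⟨$⟩ʳ c) ≡ coord q (axes M ⟨$⟩ʳ c)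
⟦⟧-agree M {p} {q} c e =
  ⟨$⟩ʳ-injective (scales M c) (trans (sym (coord-⟦⟧ M p c)) (trans e (coord-⟦⟧ M q c)))

idᴹ : ProductMap N
idᴹ = record { axes = Perm.id ; scales = λ _ → Perm.id }

_∘ᴹ_ : ProductMap N → ProductMap N → ProductMap N
M ∘ᴹ M′ = record
  { axes   = axes M ∘ₚ axes M′
  ; scales = λ c → scales M′ (axes M ⟨$⟩ʳ c) ∘ₚ scales M c
  }

⟦∘ᴹ⟧ : ∀ (M M′ : ProductMap N) → ⟦ M ∘ᴹ M′ ⟧ ≗ ⟦ M ⟧ ∘ ⟦ M′ ⟧
⟦∘ᴹ⟧ M M′ p = coord-extensional λ c → begin
  coord (⟦ M ∘ᴹ M′ ⟧ p) c                                          ≡⟨ coord-⟦⟧ (M ∘ᴹ M′) p c ⟩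
  scales M c ⟨$⟩ʳ (scales M′ (axes M ⟨$⟩ʳ c) ⟨$⟩ʳ coord p (axes M′ ⟨$⟩ʳ (axes M ⟨$⟩ʳ c)))
                                                                  ≡⟨ cong (scales M c ⟨$⟩ʳ_) (coord-⟦⟧ M′ p _) ⟨
  scales M c ⟨$⟩ʳ coord (⟦ M′ ⟧ p) (axes M ⟨$⟩ʳ c)                  ≡⟨ coord-⟦⟧ M (⟦ M′ ⟧ p) c ⟨
  coord (⟦ M ⟧ (⟦ M′ ⟧ p)) c                                        ∎
  where open ≡-Reasoning

_⁻¹ᴹ : ProductMap N → ProductMap N
M ⁻¹ᴹ = record
  { axes   = Perm.flip (axes M)
  ; scales = λ d → Perm.flip (scales M (axes M ⟨$⟩ˡ d))
  }

⟦⟧-inverseʳ : ∀ (M : ProductMap N) p → ⟦ M ⟧ (⟦ M ⁻¹ᴹ ⟧ p) ≡ p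
⟦⟧-inverseʳ M p = coord-extensional λ c → begin
  coord (⟦ M ⟧ (⟦ M ⁻¹ᴹ ⟧ p)) c                            ≡⟨ coord-⟦⟧ M _ c ⟩
  scales M c ⟨$⟩ʳ coord (⟦ M ⁻¹ᴹ ⟧ p) (σ ⟨$⟩ʳ c)            ≡⟨ cong (scales M c ⟨$⟩ʳ_) (coord-⟦⟧ (M ⁻¹ᴹ) p _) ⟩
  scales M c ⟨$⟩ʳ unscaled (σ ⟨$⟩ˡ (σ ⟨$⟩ʳ c))               ≡⟨ cong (λ d → scales M c ⟨$⟩ʳ unscaled d) (inverseˡ σ) ⟩
  scales M c ⟨$⟩ʳ unscaled c                                ≡⟨ inverseʳ (scales M c) ⟩
  coord p c                                                ∎
  where
  open ≡-Reasoning
  σ = axes M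
  unscaled : Fin 3 → Fin _
  unscaled d = scales M d ⟨$⟩ˡ coord p d

⟦⟧-inverseˡ : ∀ (M : ProductMap N) p → ⟦ M ⁻¹ᴹ ⟧ (⟦ M ⟧ p) ≡ p
⟦⟧-inverseˡ M p = coord-extensional λ d → begin
  coord (⟦ M ⁻¹ᴹ ⟧ (⟦ M ⟧ p)) d                                    ≡⟨ coord-⟦⟧ (M ⁻¹ᴹ) _ d ⟩
  scales M (σ ⟨$⟩ˡ d) ⟨$⟩ˡ coord (⟦ M ⟧ p) (σ ⟨$⟩ˡ d)                 ≡⟨ cong (scales M (σ ⟨$⟩ˡ d) ⟨$⟩ˡ_) (coord-⟦⟧ M p _) ⟩
  scales M (σ ⟨$⟩ˡ d) ⟨$⟩ˡ (scales M (σ ⟨$⟩ˡ d) ⟨$⟩ʳ coord p (σ ⟨$⟩ʳ (σ ⟨$⟩ˡ d)))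
                                                                  ≡⟨ inverseˡ (scales M (σ ⟨$⟩ˡ d)) ⟩
  coord p (σ ⟨$⟩ʳ (σ ⟨$⟩ˡ d))                                      ≡⟨ cong (coord p) (inverseʳ σ) ⟩
  coord p d                                                       ∎
  where
  open ≡-Reasoning
  σ = axes M

imageBound : ProductMap N → (Fin 3 → Fin N) → Fin 3 → Fin N
imageBound M b c = scales M c ⟨$⟩ʳ b (axes M ⟨$⟩ʳ c)

imageBound-≢ : ∀ (M : ProductMap N) B c → imageBound M (lo B) c ≢ imageBound M (hi B) c
imageBound-≢ M B c e = lo≢hi B (axes M ⟨$⟩ʳ c) (⟨$⟩ʳ-injective (scales M c) e)

imageBox : ProductMap N → BoxData N → BoxData N
imageBox M B = fromBounds _ _ (imageBound-≢ M B)

⟦⟧-inBox : ∀ (M : ProductMap N) B {p} → InBox B p → InBox (imageBox M B) (⟦ M ⟧ p)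
⟦⟧-inBox M B {p} p∈B = inBox⁺ _ _ (imageBound-≢ M B) λ c →
  subst (OneOf _ _) (sym (coord-⟦⟧ M p c)) (oneOf-map (scales M c ⟨$⟩ʳ_) (inBox⁻ (lo B) (hi B) (lo≢hi B) p∈B (axes M ⟨$⟩ʳ c)))

⟦⟧-inBox⁻ : ∀ (M : ProductMap N) B {p} → InBox (imageBox M B) (⟦ M ⟧ p) → InBox B p
⟦⟧-inBox⁻ M B {p} p∈ = inBox⁺ (lo B) (hi B) (lo≢hi B) λ d →
  subst (λ c → OneOf (lo B c) (hi B c) (coord p c)) (inverseʳ σ) (at (σ ⟨$⟩ˡ d))
  where
  σ = axes M
  at : ∀ c → OneOf (lo B (σ ⟨$⟩ʳ c)) (hi B (σ ⟨$⟩ʳ c)) (coord p (σ ⟨$⟩ʳ c))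
  at c = Sum.map (⟨$⟩ʳ-injective (scales M c)) (⟨$⟩ʳ-injective (scales M c))
           (subst (OneOf _ _) (coord-⟦⟧ M p c) (inBox⁻ _ _ (imageBound-≢ M B) p∈ c))

product⇒InH : ∀ (M : ProductMap N) {f} → f ≗ ⟦ M ⟧ → InH N f
product⇒InH M {f} f≗M = inverse⇒bijective f∘g g∘f , λ B → imageBox M B , λ q → mk⇔ (to B q) (from B q)
  where
  g = ⟦ M ⁻¹ᴹ ⟧
  f∘g : ∀ q → f (g q) ≡ q
  f∘g q = trans (f≗M (g q)) (⟦⟧-inverseʳ M q)
  g∘f : ∀ p → g (f p) ≡ p
  g∘f p = trans (cong g (f≗M p)) (⟦⟧-inverseˡ M p)
  to : ∀ B q → ∃ (λ p → InBox B p × f p ≡ q) → InBox (imageBox M B) q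
  to B q (p , p∈B , refl) = subst (InBox (imageBox M B)) (sym (f≗M p)) (⟦⟧-inBox M B p∈B)
  from : ∀ B q → InBox (imageBox M B) q → ∃ (λ p → InBox B p × f p ≡ q)
  from B q q∈ = g q , ⟦⟧-inBox⁻ M B (subst (InBox (imageBox M B)) (sym (⟦⟧-inverseʳ M q)) q∈) , f∘g q

if-reverse : ∀ b {x : Fin N} → (if b then opposite x else x) ≡ (if b then reverse else Perm.id) ⟨$⟩ʳ x
if-reverse true  = refl
if-reverse false = refl

InG⇒product : ∀ {f} → InG N f → Σ (ProductMap N) λ M → f ≗ ⟦ M ⟧
InG⇒product (genX a b _) =
  record { axes = Perm.id ; scales = λ { 0F → transpose a b ; _ → Perm.id } } , λ _ → refl
InG⇒product (genY a b _) =
  record { axes = Perm.id ; scales = λ { 1F → transpose a b ; _ → Perm.id } } , λ _ → refl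
InG⇒product (genZ a b _) =
  record { axes = Perm.id ; scales = λ { 2F → transpose a b ; _ → Perm.id } } , λ _ → refl
InG⇒product (genCube σ ε) = record { axes = σ ; scales = λ c → if ε c then reverse else Perm.id } ,
  λ _ → cong₂ _,_ (if-reverse (ε 0F)) (cong₂ _,_ (if-reverse (ε 1F)) (if-reverse (ε 2F)))
InG⇒product idG = idᴹ , λ _ → refl
InG⇒product (compG {f} f∈G g∈G) with InG⇒product f∈G | InG⇒product g∈G
... | M , f≗M | M′ , g≗M′ = M ∘ᴹ M′ , λ p → trans (trans (cong f (g≗M′ p)) (f≗M _)) (sym (⟦∘ᴹ⟧ M M′ p))
InG⇒product (invG {f} f∈G g g∘f f∘g) with InG⇒product f∈G
... | M , f≗M = M ⁻¹ᴹ , λ q → begin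
  g q                            ≡⟨ cong g (⟦⟧-inverseʳ M q) ⟨
  g (⟦ M ⟧ (⟦ M ⁻¹ᴹ ⟧ q))         ≡⟨ cong g (f≗M _) ⟨
  g (f (⟦ M ⁻¹ᴹ ⟧ q))             ≡⟨ g∘f _ ⟩
  ⟦ M ⁻¹ᴹ ⟧ q                    ∎
  where open ≡-Reasoning
InG⇒product (extG f∈G f≗g) with InG⇒product f∈G
... | M , f≗M = M , λ p → trans (sym (f≗g p)) (f≗M p)

G⊆H : ∀ f → InG N f → InH N f
G⊆H f f∈G = product⇒InH (proj₁ (InG⇒product f∈G)) (proj₂ (InG⇒product f∈G))

layer : Fin 3 → Permutation′ N → Point N → Point N
layer c π p = p [ c ]≔ (π ⟨$⟩ʳ coord p c)

layer-∘ₚ : ∀ c (π π′ : Permutation′ N) → layer c (π ∘ₚ π′) ≗ layer c π′ ∘ layer c π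
layer-∘ₚ 0F π π′ p = refl
layer-∘ₚ 1F π π′ p = refl
layer-∘ₚ 2F π π′ p = refl

layer-cong : ∀ c {π π′ : Permutation′ N} → π Perm.≈ π′ → layer c π ≗ layer c π′
layer-cong c π≈π′ p = cong (λ w → p [ c ]≔ w) (π≈π′ _)

transpose-self : ∀ (i : Fin N) → transpose i i Perm.≈ Perm.id
transpose-self i k with k ≟ i
... | yes refl = refl
... | no k≢i with k ≟ i
...   | yes k≡i = ⊥-elim (k≢i k≡i)
...   | no _    = refl

layer-transpose∈G : ∀ c (i j : Fin N) → InG N (layer c (transpose i j))
layer-transpose∈G c i j with i ≟ j
... | yes refl = extG idG λ p → sym (trans (layer-cong c {transpose i i} {Perm.id} (transpose-self i) p) ([]≔-coord p c))
layer-transpose∈G 0F i j | no i≢j = extG (genX i j i≢j) λ _ → refl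
layer-transpose∈G 1F i j | no i≢j = extG (genY i j i≢j) λ _ → refl
layer-transpose∈G 2F i j | no i≢j = extG (genZ i j i≢j) λ _ → refl

layer∈G : ∀ c (π : Permutation′ N) → InG N (layer c π)
layer∈G c π = extG (eval∈G (decompose π)) (layer-cong c {eval (decompose π)} {π} (eval-decompose π))
  where
  eval∈G : ∀ τs → InG _ (layer c (eval τs))
  eval∈G []             = extG idG λ p → sym ([]≔-coord p c)
  eval∈G ((i , j) ∷ τs) =
    extG (compG (eval∈G τs) (layer-transpose∈G c i j)) λ p → sym (layer-∘ₚ c (transpose i j) (eval τs) p)

product∈G : ∀ (M : ProductMap N) → InG N ⟦ M ⟧
product∈G M = extG (compG (layer∈G 0F (scales M 0F)) (compG (layer∈G 1F (scales M 1F))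
                     (compG (layer∈G 2F (scales M 2F)) (genCube (axes M) λ _ → false))))
                   λ _ → refl

-- The case N = 2

swap : Point 2 → Point 2
swap (0F , 0F , 0F) = 0F , 0F , 1F
swap (0F , 0F , 1F) = 0F , 0F , 0F
swap p              = p

swap-involutive : ∀ p → swap (swap p) ≡ p
swap-involutive (0F , 0F , 0F) = refl
swap-involutive (0F , 0F , 1F) = refl
swap-involutive (0F , 1F , _)  = refl
swap-involutive (1F , _ , _)   = refl

oneOf-Fin2 : ∀ {v w : Fin 2} x → v ≢ w → OneOf v w x
oneOf-Fin2 {0F} {0F} _  v≢w = ⊥-elim (v≢w refl)
oneOf-Fin2 {0F} {1F} 0F _   = inj₁ refl
oneOf-Fin2 {0F} {1F} 1F _   = inj₂ refl
oneOf-Fin2 {1F} {0F} 0F _   = inj₂ refl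
oneOf-Fin2 {1F} {0F} 1F _   = inj₁ refl
oneOf-Fin2 {1F} {1F} _  v≢w = ⊥-elim (v≢w refl)

inBox-Fin2 : ∀ (B : BoxData 2) p → InBox B p
inBox-Fin2 B p = inBox⁺ (lo B) (hi B) (lo≢hi B) λ c → oneOf-Fin2 (coord p c) (lo≢hi B c)

swap∈H : InH 2 swap
swap∈H = inverse⇒bijective swap-involutive swap-involutive , λ B → B , λ q → mk⇔ (λ _ → inBox-Fin2 B q) (λ _ → swap q , inBox-Fin2 B (swap q) , swap-involutive q)

swap∉G : ¬ InG 2 swap
swap∉G swap∈G with InG⇒product swap∈G
... | M , swap≗M = corners-≢⇒coord≢ (axes M ⟨$⟩ʳ 2F)
  (⟦⟧-agree M 2F (trans (cong (λ p → coord p 2F) (sym (swap≗M _))) (cong (λ p → coord p 2F) (swap≗M _))))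
  where
  corners-≢⇒coord≢ : ∀ c → coord {2} (0F , 0F , 0F) c ≢ coord (1F , 1F , 1F) c
  corners-≢⇒coord≢ 0F ()
  corners-≢⇒coord≢ 1F ()
  corners-≢⇒coord≢ 2F ()

-- Coboxal triples

AtMostTwo : Fin N → Fin N → Fin N → Set
AtMostTwo x y z = x ≡ y ⊎ x ≡ z ⊎ y ≡ z

-- For N ≥ 2 this says that p, q, r lie in the vertex set of a common box.
Coboxal : Point N → Point N → Point N → Set
Coboxal p q r = ∀ c → AtMostTwo (coord p c) (coord q c) (coord r c)

PreservesCoboxal : (Point N → Point N) → Set
PreservesCoboxal {N} f = ∀ {p q r : Point N} → Coboxal p q r → Coboxal (f p) (f q) (f r)

oneOf⇒atMostTwo : ∀ {v w x y z : Fin N} → OneOf v w x → OneOf v w y → OneOf v w z → AtMostTwo x y z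
oneOf⇒atMostTwo (inj₁ refl) (inj₁ refl) _           = inj₁ refl
oneOf⇒atMostTwo (inj₂ refl) (inj₂ refl) _           = inj₁ refl
oneOf⇒atMostTwo (inj₁ refl) (inj₂ refl) (inj₁ refl) = inj₂ (inj₁ refl)
oneOf⇒atMostTwo (inj₁ refl) (inj₂ refl) (inj₂ refl) = inj₂ (inj₂ refl)
oneOf⇒atMostTwo (inj₂ refl) (inj₁ refl) (inj₁ refl) = inj₂ (inj₂ refl)
oneOf⇒atMostTwo (inj₂ refl) (inj₁ refl) (inj₂ refl) = inj₂ (inj₁ refl)

atMostTwo-fresh : ∀ {x y w : Fin N} → x ≢ y → w ≢ x → w ≢ y → ¬ AtMostTwo x y w
atMostTwo-fresh x≢y w≢x w≢y (inj₁ x≡y)        = x≢y x≡y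
atMostTwo-fresh x≢y w≢x w≢y (inj₂ (inj₁ x≡w)) = w≢x (sym x≡w)
atMostTwo-fresh x≢y w≢x w≢y (inj₂ (inj₂ y≡w)) = w≢y (sym y≡w)

atMostTwo⇒oneOf : ∀ {x y z : Fin N} → x ≢ y → AtMostTwo x y z → OneOf x y z
atMostTwo⇒oneOf x≢y (inj₁ x≡y)        = ⊥-elim (x≢y x≡y)
atMostTwo⇒oneOf x≢y (inj₂ (inj₁ x≡z)) = inj₁ (sym x≡z)
atMostTwo⇒oneOf x≢y (inj₂ (inj₂ y≡z)) = inj₂ (sym y≡z)

record TwoValues (x y z : Fin N) : Set where
  field
    v w : Fin N
    v≢w : v ≢ w
    x∈  : OneOf v w x
    y∈  : OneOf v w y
    z∈  : OneOf v w z

pairValues : ∀ (a b : Fin (suc (suc m))) → ∃₂ λ v w → v ≢ w × OneOf v w a × OneOf v w b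
pairValues a b with a ≟ b
... | yes refl = a , punchIn a zero , punchInᵢ≢i a zero ∘ sym , inj₁ refl , inj₁ refl
... | no a≢b   = a , b , a≢b , inj₁ refl , inj₂ refl

atMostTwo⇒twoValues : ∀ {x y z : Fin (suc (suc m))} → AtMostTwo x y z → TwoValues x y z
atMostTwo⇒twoValues {x = x} {z = z} (inj₁ refl) with pairValues x z
... | v , w , v≢w , x∈ , z∈ = record { v = v ; w = w ; v≢w = v≢w ; x∈ = x∈ ; y∈ = x∈ ; z∈ = z∈ }
atMostTwo⇒twoValues {x = x} {y} (inj₂ (inj₁ refl)) with pairValues x y
... | v , w , v≢w , x∈ , y∈ = record { v = v ; w = w ; v≢w = v≢w ; x∈ = x∈ ; y∈ = y∈ ; z∈ = x∈ }
atMostTwo⇒twoValues {x = x} {y} (inj₂ (inj₂ refl)) with pairValues x y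
... | v , w , v≢w , x∈ , y∈ = record { v = v ; w = w ; v≢w = v≢w ; x∈ = x∈ ; y∈ = y∈ ; z∈ = y∈ }

coboxal⇒inBox : ∀ {p q r : Point (suc (suc m))} → Coboxal p q r →
                Σ (BoxData _) λ B → InBox B p × InBox B q × InBox B r
coboxal⇒inBox pqr = fromBounds l h l≢h
                  , inBox⁺ l h l≢h (x∈ ∘ values) , inBox⁺ l h l≢h (y∈ ∘ values) , inBox⁺ l h l≢h (z∈ ∘ values)
  where
  open TwoValues
  values = λ c → atMostTwo⇒twoValues (pqr c)
  l = v ∘ values
  h = w ∘ values
  l≢h = v≢w ∘ values

boxPreserving⇒preservesCoboxal : ∀ {f : Point (suc (suc m)) → Point (suc (suc m))} →
  (∀ B → Σ (BoxData _) λ B′ → ImageIsBox f B B′) → PreservesCoboxal f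
boxPreserving⇒preservesCoboxal {f = f} boxes pqr c with coboxal⇒inBox pqr
... | B , p∈ , q∈ , r∈ = oneOf⇒atMostTwo (image∈ p∈) (image∈ q∈) (image∈ r∈)
  where
  B′ = proj₁ (boxes B)
  image∈ : ∀ {s} → InBox B s → OneOf (lo B′ c) (hi B′ c) (coord (f s) c)
  image∈ s∈ = inBox⁻ (lo B′) (hi B′) (lo≢hi B′) (Equivalence.to (proj₂ (boxes B) _) (_ , s∈ , refl)) c

-- Inverting an injection of a finite set by iteration

module _ {a} {A : Set a} (encode : A → Fin m) (encode-injective : Injective _≡_ _≡_ encode)
         {f : A → A} (f-injective : Injective _≡_ _≡_ f) where

  fold-injective : ∀ k → Injective _≡_ _≡_ (λ x → fold x f k)
  fold-injective zero    e = e
  fold-injective (suc k) e = fold-injective k (f-injective e)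

  fold-period : ∀ x → ∃ λ d → 0 < d × d ≤ m × fold x f d ≡ x
  fold-period x with pigeonhole (n<1+n m) (λ i → encode (fold x f (toℕ i)))
  ... | i , j , i<j , e = d , m<n⇒0<n∸m i<j , ≤-trans (m∸n≤m (toℕ j) (toℕ i)) (toℕ≤pred[n] j) , sym x≡
    where
    open ≡-Reasoning
    d = toℕ j ∸ toℕ i
    x≡ : x ≡ fold x f d
    x≡ = fold-injective (toℕ i) (begin
      fold x f (toℕ i)             ≡⟨ encode-injective e ⟩
      fold x f (toℕ j)             ≡⟨ cong (fold x f) (m+[n∸m]≡n (<⇒≤ i<j)) ⟨
      fold x f (toℕ i + d)         ≡⟨ fold-+ x f (toℕ i) ⟩
      fold (fold x f d) f (toℕ i)  ∎)

  fold-multiple : ∀ {x d} → fold x f d ≡ x → ∀ q → fold x f (q * d) ≡ x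
  fold-multiple e zero = refl
  fold-multiple {x} {d} e (suc q) = trans (fold-+ x f d) (trans (cong (λ y → fold y f d) (fold-multiple e q)) e)

  fold-factorial : ∀ x → fold x f (m !) ≡ x
  fold-factorial x with fold-period x
  ... | suc k , _ , 1+k≤m , e with ∣-trans (m∣m*n {suc k} (k !)) (m≤n⇒m!∣n! 1+k≤m)
  ...   | divides q m!≡q*[1+k] = trans (cong (fold x f) m!≡q*[1+k]) (fold-multiple e q)

record CoboxalAutomorphism (N : ℕ) : Set where
  field
    to from      : Point N → Point N
    from∘to      : ∀ p → from (to p) ≡ p
    to∘from      : ∀ p → to (from p) ≡ p
    to-coboxal   : PreservesCoboxal to
    from-coboxal : PreservesCoboxal from

invert : CoboxalAutomorphism N → CoboxalAutomorphism N
invert φ = record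
  { to = from ; from = to ; from∘to = to∘from ; to∘from = from∘to
  ; to-coboxal = from-coboxal ; from-coboxal = to-coboxal }
  where open CoboxalAutomorphism φ

encode : Point N → Fin (N * (N * N))
encode (i , j , k) = combine i (combine j k)

encode-injective : Injective _≡_ _≡_ (encode {N})
encode-injective {x = i , j , k} {i′ , j′ , k′} e with combine-injective i _ i′ _ e
... | refl , e′ with combine-injective j k j′ k′ e′
... | refl , refl = refl

fold-coboxal : ∀ {f : Point N → Point N} → PreservesCoboxal f → ∀ k → PreservesCoboxal (λ x → fold x f k)
fold-coboxal f-coboxal zero    pqr = pqr
fold-coboxal f-coboxal (suc k) pqr = f-coboxal (fold-coboxal f-coboxal k pqr)

H⇒automorphism : ∀ {f} → InH (suc (suc m)) f → CoboxalAutomorphism (suc (suc m))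
H⇒automorphism {m} {f} ((f-injective , _) , boxes) = record
  { to           = f
  ; from         = f⁻¹
  ; from∘to      = λ p → f-injective (to∘from (f p))
  ; to∘from      = to∘from
  ; to-coboxal   = f-coboxal
  ; from-coboxal = fold-coboxal f-coboxal k
  }
  where
  size = suc (suc m) * (suc (suc m) * suc (suc m))
  k = pred (size !)
  f⁻¹ : Point _ → Point _
  f⁻¹ x = fold x f k
  to∘from : ∀ x → f (f⁻¹ x) ≡ x
  to∘from x = trans (cong (fold x f) (suc-pred (size !) {{size !≢0}})) (fold-factorial encode encode-injective f-injective x)
  f-coboxal = boxPreserving⇒preservesCoboxal boxes

-- Rigidity for N ≥ 3

module Rigidity (n : ℕ) where

  N₃ : ℕ
  N₃ = suc (suc (suc n))

  private
    variable
      p q p′ q′ A B C : Point N₃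
      a b : Fin N₃
      c u u′ : Fin 3

  0≢1 : _≢_ {A = Fin N₃} zero (suc zero)
  0≢1 ()

  fresh : (a b : Fin N₃) → ∃ λ w → w ≢ a × w ≢ b
  fresh a b with 0F ≟ a | 0F ≟ b | 1F ≟ a | 1F ≟ b
  ... | no 0≢a    | no 0≢b    | _         | _      = 0F , 0≢a , 0≢b
  ... | _         | _         | no 1≢a    | no 1≢b = 1F , 1≢a , 1≢b
  ... | yes refl  | _         | _         | yes refl = 2F , (λ ()) , (λ ())
  ... | _         | yes refl  | yes refl  | _      = 2F , (λ ()) , (λ ())
  ... | yes refl  | _         | yes ()    | _
  ... | _         | yes refl  | _         | yes ()

  Line : Fin 3 → Point N₃ → Point N₃ → Set
  Line c p q = coord p c ≢ coord q c × (∀ d → d ≢ c → coord p d ≡ coord q d)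

  -- Coboxal p q, as a predicate, is the span of p and q.
  SpanMaximal : Point N₃ → Point N₃ → Set
  SpanMaximal p q = p ≢ q × (∀ {p′ q′} → p′ ≢ q′ → Coboxal p q ⊆ Coboxal p′ q′ → Coboxal p′ q′ ⊆ Coboxal p q)

  coboxal-left : Coboxal p q p
  coboxal-left c = inj₂ (inj₁ refl)

  coboxal-right : Coboxal p q q
  coboxal-right c = inj₂ (inj₂ refl)

  -- In a coordinate where p and q agree, their span is unconstrained; a value outside
  -- {p′ c, q′ c}, which exists as N ≥ 3, then gives a point outside the span of p′, q′.
  span-agree : ∀ c → Coboxal p q ⊆ Coboxal p′ q′ → coord p c ≡ coord q c → coord p′ c ≡ coord q′ c
  span-agree {p = p} {q = q} {p′ = p′} {q′ = q′} c pq⊆ pc≡qc with coord p′ c ≟ coord q′ c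
  ... | yes p′c≡q′c = p′c≡q′c
  ... | no p′c≢q′c with fresh (coord p′ c) (coord q′ c)
  ...   | w , w≢p′c , w≢q′c =
    ⊥-elim (atMostTwo-fresh p′c≢q′c w≢p′c w≢q′c (subst (AtMostTwo _ _) (coord∘[]≔ p c) (pq⊆ r∈ c)))
    where
    r∈ : Coboxal p q (p [ c ]≔ w)
    r∈ d with d ≟ c
    ... | yes refl = inj₁ pc≡qc
    ... | no d≢c   = inj₂ (inj₁ (sym (coord∘[]≔′ p d≢c)))

  line⇒spanMaximal : Line c p q → SpanMaximal p q
  line⇒spanMaximal {c = c} {p = p} {q = q} (pc≢qc , agree) = (λ { refl → pc≢qc refl }) , maximal
    where
    maximal : p′ ≢ q′ → Coboxal p q ⊆ Coboxal p′ q′ → Coboxal p′ q′ ⊆ Coboxal p q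
    maximal {p′} {q′} p′≢q′ pq⊆ {r} r∈ d with d ≟ c
    ... | no d≢c   = inj₁ (agree d d≢c)
    ... | yes refl = oneOf⇒atMostTwo (onLine (pq⊆ coboxal-left)) (onLine (pq⊆ coboxal-right)) (onLine r∈)
      where
      p′c≢q′c : coord p′ d ≢ coord q′ d
      p′c≢q′c p′c≡q′c with ≢⇒coord≢ p′≢q′
      ... | e , p′e≢q′e with e ≟ d
      ...   | yes refl = p′e≢q′e p′c≡q′c
      ...   | no e≢d   = p′e≢q′e (span-agree e pq⊆ (agree e e≢d))
      onLine : ∀ {s} → Coboxal p′ q′ s → OneOf (coord p′ d) (coord q′ d) (coord s d)
      onLine s∈ = atMostTwo⇒oneOf p′c≢q′c (s∈ d)

  spanMaximal⇒line : SpanMaximal p q → ∃ λ c → Line c p q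
  spanMaximal⇒line {p = p} {q = q} (p≢q , maximal) with ≢⇒coord≢ p≢q
  ... | c , pc≢qc = c , pc≢qc , λ d d≢c → span-agree d (maximal p≢p₁ pq⊆pp₁) (sym (coord∘[]≔′ p d≢c))
    where
    p₁ = p [ c ]≔ coord q c
    p≢p₁ : p ≢ p₁
    p≢p₁ p≡p₁ = pc≢qc (trans (cong (λ s → coord s c) p≡p₁) (coord∘[]≔ p c))
    pq⊆pp₁ : Coboxal p q ⊆ Coboxal p p₁
    pq⊆pp₁ r∈ d with d ≟ c
    ... | yes refl = subst (λ x → AtMostTwo _ x _) (sym (coord∘[]≔ p d)) (r∈ d)
    ... | no d≢c   = inj₁ (sym (coord∘[]≔′ p d≢c))

  line-sym : Line c p q → Line c q p
  line-sym (pc≢qc , agree) = pc≢qc ∘ sym , λ d d≢c → sym (agree d d≢c)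

  span-direction : Line u A B → Line u′ p q → Coboxal A B ⊆ Coboxal p q → u ≡ u′
  span-direction {u = u} {u′ = u′} (_ , agree) (pu′≢qu′ , _) AB⊆ with u ≟ u′
  ... | yes u≡u′ = u≡u′
  ... | no u≢u′  = ⊥-elim (pu′≢qu′ (span-agree u′ AB⊆ (agree u′ (u≢u′ ∘ sym))))

  line-direction-unique : Line u A B → Line u′ A B → u ≡ u′
  line-direction-unique l l′ = span-direction l l′ id

  triangle-direction : Line u A B → Line u′ A C → Line c B C → u ≡ u′
  triangle-direction {u = u} {u′ = u′} {c = c} (Au≢Bu , AB) (Au′≢Cu′ , AC) (_ , BC) with u ≟ u′
  ... | yes u≡u′ = u≡u′
  ... | no u≢u′ with u ≟ c | u′ ≟ c
  ...   | yes u≡c | yes u′≡c = trans u≡c (sym u′≡c)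
  ...   | no u≢c  | _        = ⊥-elim (Au≢Bu (trans (AC u u≢u′) (sym (BC u u≢c))))
  ...   | yes _   | no u′≢c  = ⊥-elim (Au′≢Cu′ (trans (AB u′ (u≢u′ ∘ sym)) (BC u′ u′≢c)))

  set-line : a ≢ b → Line c (p [ c ]≔ a) (p [ c ]≔ b)
  set-line {c = c} {p = p} a≢b =
    (λ e → a≢b (trans (sym (coord∘[]≔ p c)) (trans e (coord∘[]≔ p c)))) ,
    λ d d≢c → trans (coord∘[]≔′ p d≢c) (sym (coord∘[]≔′ p d≢c))

  span-⊆-axis : ∀ c → Coboxal p q ⊆ Coboxal (axis c (coord p c)) (axis c (coord q c))
  span-⊆-axis c r∈ d with d ≟ c
  ... | yes refl = subst₂ (λ x y → AtMostTwo x y _) (sym (coord∘[]≔ origin d)) (sym (coord∘[]≔ origin d)) (r∈ d)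
  ... | no d≢c   = inj₁ (trans (coord∘[]≔′ origin d≢c) (sym (coord∘[]≔′ origin d≢c)))

  coboxal-cong : p ≡ p′ → q ≡ q′ → Coboxal p q ⊆ Coboxal p′ q′
  coboxal-cong refl refl r∈ = r∈

  module _ (φ : CoboxalAutomorphism N₃) where
    open CoboxalAutomorphism φ

    to-injective : to p ≡ to q → p ≡ q
    to-injective {p = p} {q = q} e = trans (sym (from∘to p)) (trans (cong from e) (from∘to q))

    to-⊆ : Coboxal p q ⊆ Coboxal p′ q′ → Coboxal (to p) (to q) ⊆ Coboxal (to p′) (to q′)
    to-⊆ {p = p} {q = q} pq⊆ r∈ =
      subst (Coboxal _ _) (to∘from _) (to-coboxal (pq⊆ (coboxal-cong (from∘to p) (from∘to q) (from-coboxal r∈))))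

  module Directions (φ : CoboxalAutomorphism N₃) where
    open CoboxalAutomorphism φ

    spanMaximal-image : SpanMaximal p q → SpanMaximal (to p) (to q)
    spanMaximal-image {p = p} {q = q} (p≢q , maximal) = p≢q ∘ to-injective φ , maximal′
      where
      maximal′ : p′ ≢ q′ → Coboxal (to p) (to q) ⊆ Coboxal p′ q′ → Coboxal p′ q′ ⊆ Coboxal (to p) (to q)
      maximal′ {p′} {q′} p′≢q′ ⊆p′q′ r∈ =
        to-⊆ φ (maximal from-p′≢q′ pq⊆) (coboxal-cong (sym (to∘from p′)) (sym (to∘from q′)) r∈)
        where
        from-p′≢q′ = p′≢q′ ∘ to-injective (invert φ)
        pq⊆ : Coboxal p q ⊆ Coboxal (from p′) (from q′)
        pq⊆ r∈ = to-⊆ (invert φ) ⊆p′q′ (coboxal-cong (sym (from∘to p)) (sym (from∘to q)) r∈)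

    line-image : Line c p q → ∃ λ d → Line d (to p) (to q)
    line-image l = spanMaximal⇒line (spanMaximal-image (line⇒spanMaximal l))

    image-axis-line : ∀ c → a ≢ b → ∃ λ d → Line d (to (axis c a)) (to (axis c b))
    image-axis-line c a≢b = line-image (set-line {p = origin} a≢b)

    direction : Fin 3 → Fin 3
    direction c = proj₁ (image-axis-line c 0≢1)

    unit-line : ∀ c → Line (direction c) (to (axis c zero)) (to (axis c (suc zero)))
    unit-line c = proj₂ (image-axis-line c 0≢1)

    private
      shared-endpoint : ∀ {x} → a ≢ b → a ≢ x →
        Line u (to (axis c a)) (to (axis c b)) → Line u′ (to (axis c a)) (to (axis c x)) → u ≡ u′
      shared-endpoint {b = b} {c = c} {x = x} _ _ l l′ with b ≟ x
      ... | yes refl = line-direction-unique l l′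
      ... | no b≢x   = triangle-direction l l′ (proj₂ (image-axis-line c b≢x))

    axis-image-direction : a ≢ b → Line u (to (axis c a)) (to (axis c b)) → u ≡ direction c
    axis-image-direction {a = a} {c = c} a≢b l with a ≟ zero
    ... | yes refl = shared-endpoint a≢b (λ ()) l (unit-line c)
    ... | no a≢0 with image-axis-line c a≢0
    ...   | d , l₀ = trans (shared-endpoint a≢b a≢0 l l₀) (shared-endpoint (a≢0 ∘ sym) (λ ()) (line-sym l₀) (unit-line c))

    image-direction : Line c p q → Line u (to p) (to q) → u ≡ direction c
    image-direction {c = c} {p = p} {q = q} (pc≢qc , _) l with image-axis-line c pc≢qc
    ... | d , l₀ = trans (span-direction l l₀ (to-⊆ φ (span-⊆-axis c))) (axis-image-direction pc≢qc l₀)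

  direction-inverse : ∀ φ c → Directions.direction (invert φ) (Directions.direction φ c) ≡ c
  direction-inverse φ c = sym (Directions.image-direction (invert φ) (Directions.unit-line φ c) back)
    where
    open CoboxalAutomorphism φ
    base : Line c (axis c zero) (axis c (suc zero))
    base = set-line 0≢1
    back : Line c (from (to (axis c zero))) (from (to (axis c (suc zero))))
    back = subst₂ (Line c) (sym (from∘to _)) (sym (from∘to _)) base

  module Coordinates (φ : CoboxalAutomorphism N₃) where
    open CoboxalAutomorphism φ
    open Directions φ

    codirection : Fin 3 → Fin 3
    codirection = Directions.direction (invert φ)

    coord-invariant : ∀ u {p c w} → c ≢ codirection u → coord (to (p [ c ]≔ w)) u ≡ coord (to p) u
    coord-invariant u {p} {c} {w} c≢ with coord p c ≟ w
    ... | yes refl = cong (λ s → coord (to s) u) ([]≔-coord p c)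
    ... | no pc≢w = sym (proj₂ (proj₂ (line-image l)) u u≢d)
      where
      l : Line c p (p [ c ]≔ w)
      l = subst (λ s → Line c s (p [ c ]≔ w)) ([]≔-coord p c) (set-line pc≢w)
      u≢d : u ≢ proj₁ (line-image l)
      u≢d u≡d = c≢ (begin
        c                                ≡⟨ direction-inverse φ c ⟨
        codirection (direction c)        ≡⟨ cong codirection (image-direction l (proj₂ (line-image l))) ⟨
        codirection (proj₁ (line-image l)) ≡⟨ cong codirection u≡d ⟨
        codirection u                    ∎)
        where open ≡-Reasoning

    scale : Fin 3 → Fin N₃ → Fin N₃
    scale u a = coord (to (axis (codirection u) a)) u

    coord-image : ∀ p u → coord (to p) u ≡ scale u (coord p (codirection u))
    coord-image p u = depends-only (λ s → coord (to s) u) (codirection u) (coord-invariant u) p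

    scale-injective : ∀ u → Injective _≡_ _≡_ (scale u)
    scale-injective u {a} {b} e with a ≟ b
    ... | yes a≡b = a≡b
    ... | no a≢b with image-axis-line (codirection u) a≢b
    ...   | d , l = ⊥-elim (proj₁ l (subst (λ v → coord _ v ≡ coord _ v) (sym d≡u) e))
      where
      d≡u : d ≡ u
      d≡u = trans (image-direction (set-line a≢b) l) (direction-inverse (invert φ) u)

    unscale : Fin 3 → Fin N₃ → Fin N₃
    unscale u b = coord (from (axis u b)) (codirection u)

    scale-unscale : ∀ u b → scale u (unscale u b) ≡ b
    scale-unscale u b = begin
      scale u (coord (from (axis u b)) (codirection u)) ≡⟨ coord-image _ u ⟨
      coord (to (from (axis u b))) u                    ≡⟨ cong (λ s → coord s u) (to∘from _) ⟩
      coord (axis u b) u                                ≡⟨ coord∘[]≔ origin u ⟩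
      b                                                 ∎
      where open ≡-Reasoning

    productMap : ProductMap N₃
    productMap = record
      { axes   = permutation codirection direction (direction-inverse φ) (direction-inverse (invert φ))
      ; scales = λ u → permutation (scale u) (unscale u) (scale-unscale u)
                                   (λ a → scale-injective u (scale-unscale u (scale u a)))
      }

    to≗product : to ≗ ⟦ productMap ⟧
    to≗product p = coord-extensional λ u → trans (coord-image p u) (sym (coord-⟦⟧ productMap p u))

  H⊆G : ∀ f → InH N₃ f → InG N₃ f
  H⊆G f f∈H = extG (product∈G productMap) λ p → sym (to≗product p)
    where open Coordinates (H⇒automorphism f∈H)

rigidity : 3 ≤ N → ∀ f → InH N f → InG N f
rigidity (s≤s (s≤s (s≤s _))) = Rigidity.H⊆G _

theorem1 : (N : ℕ) → 2 ≤ N →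
    (∀ f → InG N f → InH N f) ×
    (N ≡ 2 → ∃ λ f → InH N f × ¬ InG N f) ×
    (3 ≤ N → ∀ f → InH N f → InG N f)
theorem1 N _ = G⊆H , (λ { refl → swap , swap∈H , swap∉G }) , rigidity
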